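{- For every LTL[REG] formula $\varphi$ in negation normal form there is an alternating Büchi automaton $\mathcal{A}$ over the alphabet $2^{AP}\times\Sigma$ with $\mathcal{L}(\mathcal{A})=\mathcal{L}(\varphi)$ whose size is linear in $|\varphi|$.
   Context: Fix a finite set $AP$ of atomic propositions and a finite set $\Sigma$ of actions. For a Kripke transition system $(S,\rightarrow,\lambda)$ with $\rightarrow\subseteq S\times\Sigma\times S$ and $\lambda:S\to2^{AP}$, a path is an infinite sequence $\pi=s_0a_0s_1a_1\dots$ with $(s_i,a_i,s_{i+1})\in\rightarrow$; its trace is $(\lambda(s_0),a_0)(\lambda(s_1),a_1)\dots\in(2^{AP}\times\Sigma)^\omega$; $\pi^i=s_ia_is_{i+1}\dots$, $\pi(i)=s_i$, $Actions(\pi,n)=a_0\dots a_n$. LTL[REG] formulae in negation normal form (NNF) are given by $\varphi::=ap\mid\neg ap\mid\varphi\land\varphi\mid\varphi\lor\varphi\mid\varphi\,\mathcal{U}^{\mathcal{A}}\varphi\mid\varphi\,\mathcal{R}^{\mathcal{A}}\varphi$ where $\mathcal{A}$ is a finite automaton (DFA or NFA) over $\Sigma$. Semantics: $\pi\models ap$ iff $ap\in\lambda(\pi(0))$; $\neg,\land,\lor$ as usual; $\pi\models\varphi_1\mathcal{U}^{\mathcal{A}}\varphi_2$ iff $\exists k$: $\pi^k\models\varphi_2$, $\forall j<k:\pi^j\models\varphi_1$, and $Actions(\pi,k)\in\mathcal{L}(\mathcal{A})$; $\pi\models\varphi_1\mathcal{R}^{\mathcal{A}}\varphi_2$ iff for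 all $i$: $Actions(\pi,i)\notin\mathcal{L}(\mathcal{A})$ or $\pi^i\models\varphi_2$ or $\exists j<i:\pi^j\models\varphi_1$. $\mathcal{L}(\varphi)$ is the set of traces of paths satisfying $\varphi$. $|\varphi|$ is the number of operators plus the sizes (states plus transitions) of the automata occurring in $\varphi$. An alternating Büchi automaton (ABA) is $(Q,\Sigma',\delta,q_0,F)$ with $\delta:Q\times\Sigma'\to\mathbb{B}^+(Q)$ (positive Boolean formulae over $Q$; $\varepsilon$-transitions are allowed), accepting an infinite word iff it has a run tree in which every infinite branch visits $F$ infinitely often; its size is the number of states plus transitions. -}

module Defs where

open import Data.Nat using (ℕ; zero; suc; _+_; _*_; _≤_; _<_)
open import Data.Fin using (Fin)
open import Data.Fin.Subset using (Subset; _∈_)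
open import Data.Bool using (Bool; true; false)
open import Data.Vec using (Vec; []; _∷_)
open import Data.List using (List; []; _∷_; map; length; upTo; allFin; cartesianProduct)
open import Data.Nat.ListAction using (sum)
open import Data.List.Membership.Propositional renaming (_∈_ to _∈ₗ_)
open import Data.Maybe using (Maybe; just; nothing)
open import Data.Product using (Σ; _×_; _,_)
open import Data.Sum using (_⊎_)
open import Data.Unit using (⊤)
open import Data.Empty using (⊥)
open import Relation.Nullary using (¬_)
open import Relation.Binary.PropositionalEquality using (_≡_)

allSubsets : (n : ℕ) → List (Subset n)
allSubsets zero = [] ∷ []
allSubsets (suc n) = map (true ∷_) (allSubsets n) Data.List.++ map (false ∷_) (allSubsets n)

data PBF (Q : Set) : Set where
  tt ff : PBF Q
  atom  : Q → PBF Q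
  _∧ᵇ_ _∨ᵇ_ : PBF Q → PBF Q → PBF Q

Sat : {Q : Set} → (Q → Set) → PBF Q → Set
Sat Y tt = ⊤
Sat Y ff = ⊥
Sat Y (atom q) = Y q
Sat Y (f ∧ᵇ g) = Sat Y f × Sat Y g
Sat Y (f ∨ᵇ g) = Sat Y f ⊎ Sat Y g

pbfSize : {Q : Set} → PBF Q → ℕ
pbfSize tt = 1
pbfSize ff = 1
pbfSize (atom _) = 1
pbfSize (f ∧ᵇ g) = suc (pbfSize f + pbfSize g)
pbfSize (f ∨ᵇ g) = suc (pbfSize f + pbfSize g)

module LTLREG (nAP nΣ : ℕ) where

  AP : Set
  AP = Fin nAP

  Act : Set
  Act = Fin nΣ

  Letter : Set
  Letter = Subset nAP × Act

  Word : Set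
  Word = ℕ → Letter

  letters : List Letter
  letters = cartesianProduct (allSubsets nAP) (allFin nΣ)

  record NFA : Set where
    field
      nStates     : ℕ
      initial     : Subset nStates
      final       : Subset nStates
      transitions : List (Fin nStates × Act × Fin nStates)

  data NFARun (A : NFA) : Fin (NFA.nStates A) → List Act → Fin (NFA.nStates A) → Set where
    done : ∀ {q} → NFARun A q [] q
    step : ∀ {q a q' w r} → (q , a , q') ∈ₗ NFA.transitions A →
           NFARun A q' w r → NFARun A q (a ∷ w) r

  NFAAccepts : NFA → List Act → Set
  NFAAccepts A u = Σ (Fin (NFA.nStates A)) λ q₀ → Σ (Fin (NFA.nStates A)) λ r →
    (q₀ ∈ NFA.initial A) × (r ∈ NFA.final A) × NFARun A q₀ u r

  nfaSize : NFA → ℕ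
  nfaSize A = NFA.nStates A + length (NFA.transitions A)

  data Formula : Set where
    ap nap          : AP → Formula
    _∧ᶠ_ _∨ᶠ_       : Formula → Formula → Formula
    U[_] R[_]       : NFA → Formula → Formula → Formula   -- U[ A ] φ₁ φ₂ = φ₁ U^A φ₂

  ∣_∣ : Formula → ℕ
  ∣ ap _ ∣ = 1
  ∣ nap _ ∣ = 1
  ∣ φ ∧ᶠ ψ ∣ = suc (∣ φ ∣ + ∣ ψ ∣)
  ∣ φ ∨ᶠ ψ ∣ = suc (∣ φ ∣ + ∣ ψ ∣)
  ∣ U[ A ] φ ψ ∣ = suc (nfaSize A + ∣ φ ∣ + ∣ ψ ∣)
  ∣ R[ A ] φ ψ ∣ = suc (nfaSize A + ∣ φ ∣ + ∣ ψ ∣)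

  record Kripke : Set₁ where
    field
      S     : Set
      trans : S → Act → S → Set
      label : S → Subset nAP

  record Path (K : Kripke) : Set where
    field
      state : ℕ → Kripke.S K
      act   : ℕ → Act
      valid : ∀ i → Kripke.trans K (state i) (act i) (state (suc i))

  suffix : ∀ {K} → Path K → ℕ → Path K
  suffix π k = record
    { state = λ i → Path.state π (i + k)
    ; act   = λ i → Path.act π (i + k)
    ; valid = λ i → Path.valid π (i + k) }

  -- Actions(π, n) = a₀ … aₙ
  actions : ∀ {K} → Path K → ℕ → List Act
  actions π n = map (Path.act π) (upTo (suc n))

  trace : ∀ {K} → Path K → Word
  trace {K} π i = Kripke.label K (Path.state π i) , Path.act π i

  _⊨_ : ∀ {K} → Path K → Formula → Set
  _⊨_ {K} π (ap p) = p ∈ Kripke.label K (Path.state π 0)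
  _⊨_ {K} π (nap p) = ¬ (p ∈ Kripke.label K (Path.state π 0))
  π ⊨ (φ ∧ᶠ ψ) = (π ⊨ φ) × (π ⊨ ψ)
  π ⊨ (φ ∨ᶠ ψ) = (π ⊨ φ) ⊎ (π ⊨ ψ)
  π ⊨ (U[ A ] φ ψ) = Σ ℕ λ k →
    (suffix π k ⊨ ψ) × (∀ j → j < k → suffix π j ⊨ φ) × NFAAccepts A (actions π k)
  π ⊨ (R[ A ] φ ψ) = ∀ i →
    ¬ NFAAccepts A (actions π i) ⊎ (suffix π i ⊨ ψ) ⊎ (Σ ℕ λ j → j < i × (suffix π j ⊨ φ))

  Lφ : Formula → Word → Set₁
  Lφ φ w = Σ Kripke λ K → Σ (Path K) λ π → (∀ i → trace π i ≡ w i) × (π ⊨ φ)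

  -- Alternating Büchi automata over 2^AP × Σ with ε-transitions
  -- δ q (just a) : transition on letter a;  δ q nothing : ε-transition

  record ABA : Set where
    field
      nQ : ℕ
      δ  : Fin nQ → Maybe Letter → PBF (Fin nQ)
      q₀ : Fin nQ
      F  : Subset nQ

  abaSize : ABA → ℕ
  abaSize A = ABA.nQ A +
    sum (map (λ q → sum (map (λ l → pbfSize (ABA.δ A q l)) (nothing ∷ map just letters)))
             (allFin (ABA.nQ A)))

  record Run (A : ABA) (w : Word) : Set₁ where
    open ABA A
    field
      Node      : Set
      root      : Node
      nstate    : Node → Fin nQ
      pos       : Node → ℕ
      child     : Node → Node → Set
      rootState : nstate root ≡ q₀
      rootPos   : pos root ≡ 0
      consistent : ∀ x →
        ((∀ y → child x y → pos y ≡ suc (pos x)) ×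
          Sat (λ q → Σ Node λ y → child x y × nstate y ≡ q) (δ (nstate x) (just (w (pos x)))))
        ⊎
        ((∀ y → child x y → pos y ≡ pos x) ×
          Sat (λ q → Σ Node λ y → child x y × nstate y ≡ q) (δ (nstate x) nothing))
      accepting : ∀ (b : ℕ → Node) → b 0 ≡ root → (∀ k → child (b k) (b (suc k))) →
        ∀ k → Σ ℕ λ m → k ≤ m × nstate (b m) ∈ F

  ABAAccepts : ABA → Word → Set₁
  ABAAccepts A w = Run A w

module Submission where

-- The states of the automaton are the subformulae of Φ together with three
-- copies of the states of each NFA A occurring in Φ: for φ U^A ψ, 'uAt q'
-- asserts the until with A in state q and unfolds (by an ε-move) into
-- "ψ and the current action leads q to a final state" or "φ and uAt q' one
-- step later for a successor q'"; release is dual.  Only the pending until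
-- states are non-accepting.  Correctness is proved against a word semantics
-- 'Holds' in which regular until/release are unfolded step by step; it agrees
-- with the path semantics (language⇔Holds).  Completeness runs over all true
-- state assertions, ranked by the distance to pending untils; soundness shows
-- every reachable node of an accepting run true, by induction on subformulae.
-- For the size, each state gets a weight bounding its transition formulae,
-- and the weights of all states of Φ sum to at most 11·|Φ|.

open import Defs
open import Data.Nat using (ℕ; _*_; _≤_)
open import Data.Product using (Σ; _×_)
open import Function.Bundles using (_⇔_)
open import Axiom.ExcludedMiddle using (ExcludedMiddle)

open import Level using (0ℓ)
open import Data.Bool using (Bool; true; false; if_then_else_)
open import Data.Empty using (⊥; ⊥-elim)
open import Data.Unit using (⊤; tt)
open import Data.Nat using (zero; suc; _+_; _∸_; _<_; z≤n; s≤s)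
open import Data.Nat.Properties hiding (_≟_)
open import Data.Nat.Induction using (<-wellFounded)
open import Data.Nat.ListAction using (sum)
open import Data.Nat.Tactic.RingSolver using (solve-∀)
open import Data.Fin using (Fin; splitAt; _↑ˡ_; _↑ʳ_; _≟_) renaming (zero to fzero; suc to fsuc)
open import Data.Fin.Properties using (splitAt-↑ˡ; splitAt-↑ʳ)
open import Data.Fin.Subset using (_∈_)
open import Data.Fin.Subset.Properties using (_∈?_)
open import Data.List using (List; []; _∷_; map; length; tabulate; filter; allFin; upTo; applyUpTo)
open import Data.List.Properties using (length-map; length-filter; length-tabulate; map-upTo; map-tabulate; map-cong)
open import Data.List.Membership.Propositional using (find; lose) renaming (_∈_ to _∈ₗ_)
open import Data.List.Membership.Propositional.Properties using (∈-map⁺; ∈-map⁻; ∈-filter⁺; ∈-filter⁻; ∈-allFin)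
open import Data.List.Relation.Unary.Any using (here; there; any?)
open import Data.Maybe using (Maybe; just; nothing)
open import Data.Product using (∃; _,_; proj₁; proj₂)
import Data.Product as Product
open import Data.Sum using (_⊎_; inj₁; inj₂; [_,_])
import Data.Sum as Sum
import Data.Vec as Vec
open import Data.Vec.Properties using (lookup∘tabulate; []=⇒lookup; lookup⇒[]=)
open import Function.Bundles using (mk⇔; Equivalence)
open Equivalence using () renaming (to to fwd; from to bwd)
open import Induction.InfiniteDescent using (descent∧wf⇒empty)
open import Relation.Nullary using (Dec; yes; no; does; map′; ¬_; ¬?)
open import Relation.Binary.PropositionalEquality hiding ([_])

mapPBF : {Q R : Set} → (Q → R) → PBF Q → PBF R
mapPBF f tt = tt
mapPBF f ff = ff
mapPBF f (atom q) = atom (f q)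
mapPBF f (g ∧ᵇ h) = mapPBF f g ∧ᵇ mapPBF f h
mapPBF f (g ∨ᵇ h) = mapPBF f g ∨ᵇ mapPBF f h

pbfSize-map : {Q R : Set} (f : Q → R) (x : PBF Q) → pbfSize (mapPBF f x) ≡ pbfSize x
pbfSize-map f tt = refl
pbfSize-map f ff = refl
pbfSize-map f (atom q) = refl
pbfSize-map f (x ∧ᵇ y) = cong₂ (λ a b → suc (a + b)) (pbfSize-map f x) (pbfSize-map f y)
pbfSize-map f (x ∨ᵇ y) = cong₂ (λ a b → suc (a + b)) (pbfSize-map f x) (pbfSize-map f y)

Sat-mono : {Q : Set} {Y Z : Q → Set} → (∀ q → Y q → Z q) → (x : PBF Q) → Sat Y x → Sat Z x
Sat-mono h tt s = tt
Sat-mono h (atom q) s = h q s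
Sat-mono h (x ∧ᵇ y) (s , t) = Sat-mono h x s , Sat-mono h y t
Sat-mono h (x ∨ᵇ y) (inj₁ s) = inj₁ (Sat-mono h x s)
Sat-mono h (x ∨ᵇ y) (inj₂ s) = inj₂ (Sat-mono h y s)

module _ {Q R : Set} {Y : R → Set} (f : Q → R) where

  Sat-map⁺ : (x : PBF Q) → Sat (λ q → Y (f q)) x → Sat Y (mapPBF f x)
  Sat-map⁺ tt s = tt
  Sat-map⁺ (atom q) s = s
  Sat-map⁺ (x ∧ᵇ y) (s , t) = Sat-map⁺ x s , Sat-map⁺ y t
  Sat-map⁺ (x ∨ᵇ y) (inj₁ s) = inj₁ (Sat-map⁺ x s)
  Sat-map⁺ (x ∨ᵇ y) (inj₂ s) = inj₂ (Sat-map⁺ y s)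

  Sat-map⁻ : (x : PBF Q) → Sat Y (mapPBF f x) → Sat (λ q → Y (f q)) x
  Sat-map⁻ tt s = tt
  Sat-map⁻ (atom q) s = s
  Sat-map⁻ (x ∧ᵇ y) (s , t) = Sat-map⁻ x s , Sat-map⁻ y t
  Sat-map⁻ (x ∨ᵇ y) (inj₁ s) = inj₁ (Sat-map⁻ x s)
  Sat-map⁻ (x ∨ᵇ y) (inj₂ s) = inj₂ (Sat-map⁻ y s)

truth : {Q P : Set} → Dec P → PBF Q
truth (yes _) = tt
truth (no _) = ff

anyOf allOf : {Q X : Set} → (X → Q) → List X → PBF Q
anyOf f [] = ff
anyOf f (x ∷ xs) = atom (f x) ∨ᵇ anyOf f xs
allOf f [] = tt
allOf f (x ∷ xs) = atom (f x) ∧ᵇ allOf f xs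

module _ {Q : Set} {Y : Q → Set} where

  Sat-truth⁺ : {P : Set} (d : Dec P) → P → Sat Y (truth d)
  Sat-truth⁺ (yes _) _ = tt
  Sat-truth⁺ (no ¬p) p = ¬p p

  Sat-truth⁻ : {P : Set} (d : Dec P) → Sat Y (truth d) → P
  Sat-truth⁻ (yes p) _ = p

  module _ {X : Set} (f : X → Q) where

    Sat-anyOf⁺ : ∀ {xs x} → x ∈ₗ xs → Y (f x) → Sat Y (anyOf f xs)
    Sat-anyOf⁺ (here refl) y = inj₁ y
    Sat-anyOf⁺ (there m) y = inj₂ (Sat-anyOf⁺ m y)

    Sat-anyOf⁻ : ∀ xs → Sat Y (anyOf f xs) → ∃ λ x → x ∈ₗ xs × Y (f x)
    Sat-anyOf⁻ (x ∷ xs) (inj₁ y) = x , here refl , y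
    Sat-anyOf⁻ (x ∷ xs) (inj₂ s) with Sat-anyOf⁻ xs s
    ... | x' , m , y = x' , there m , y

    Sat-allOf⁺ : ∀ xs → (∀ x → x ∈ₗ xs → Y (f x)) → Sat Y (allOf f xs)
    Sat-allOf⁺ [] h = tt
    Sat-allOf⁺ (x ∷ xs) h = h x (here refl) , Sat-allOf⁺ xs (λ x' m → h x' (there m))

    Sat-allOf⁻ : ∀ {xs} → Sat Y (allOf f xs) → ∀ x → x ∈ₗ xs → Y (f x)
    Sat-allOf⁻ (y , _) x (here refl) = y
    Sat-allOf⁻ (_ , s) x (there m) = Sat-allOf⁻ s x m

pbfSize-truth : {Q P : Set} (d : Dec P) → pbfSize {Q} (truth d) ≡ 1
pbfSize-truth (yes _) = refl
pbfSize-truth (no _) = refl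

pbfSize-anyOf : {Q X : Set} (f : X → Q) (xs : List X) → pbfSize (anyOf f xs) ≡ 1 + 2 * length xs
pbfSize-anyOf f [] = refl
pbfSize-anyOf f (x ∷ xs) = trans (cong (2 +_) (pbfSize-anyOf f xs)) (cong suc (sym (*-suc 2 (length xs))))

pbfSize-allOf : {Q X : Set} (f : X → Q) (xs : List X) → pbfSize (allOf f xs) ≡ 1 + 2 * length xs
pbfSize-allOf f [] = refl
pbfSize-allOf f (x ∷ xs) = trans (cong (2 +_) (pbfSize-allOf f xs)) (cong suc (sym (*-suc 2 (length xs))))

-- A state either
-- reads the current letter (and its successors sit one position later)
-- or makes an ε-move (and its successors stay at the same position).

data Move (L Q : Set) : Set where
  read : (L → PBF Q) → Move L Q
  skip : PBF Q → Move L Q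

module _ {L : Set} where

  mapMove : {Q R : Set} → (Q → R) → Move L Q → Move L R
  mapMove f (read g) = read (λ ℓ → mapPBF f (g ℓ))
  mapMove f (skip g) = skip (mapPBF f g)

  advance : {Q : Set} → Move L Q → ℕ → ℕ
  advance (read _) i = suc i
  advance (skip _) i = i

  enabled : {Q : Set} → Move L Q → L → PBF Q
  enabled (read g) ℓ = g ℓ
  enabled (skip g) ℓ = g

  fires : {Q : Set} → Move L Q → Maybe L → PBF Q
  fires (read g) (just ℓ) = g ℓ
  fires (read g) nothing = ff
  fires (skip g) (just _) = ff
  fires (skip g) nothing = g

  Bounded : {Q : Set} → Move L Q → ℕ → Set
  Bounded (read g) B = ∀ ℓ → pbfSize (g ℓ) ≤ B
  Bounded (skip g) B = pbfSize g ≤ B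

  Bounded-map : {Q R : Set} (f : Q → R) (m : Move L Q) {B : ℕ} → Bounded m B → Bounded (mapMove f m) B
  Bounded-map f (read g) h ℓ = subst (_≤ _) (sym (pbfSize-map f (g ℓ))) (h ℓ)
  Bounded-map f (skip g) h = subst (_≤ _) (sym (pbfSize-map f g)) h

  pbfSize-fires : {Q : Set} (m : Move L Q) {B : ℕ} → 1 ≤ B → Bounded m B → ∀ l → pbfSize (fires m l) ≤ B
  pbfSize-fires (read g) B≥1 h (just ℓ) = h ℓ
  pbfSize-fires (read g) B≥1 h nothing = B≥1
  pbfSize-fires (skip g) B≥1 h (just ℓ) = B≥1
  pbfSize-fires (skip g) B≥1 h nothing = h

  module _ {Q : Set} {Y : Q → Set} {C : ℕ → Set} {i : ℕ} {ℓ : L} where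

    enabled⇒fires : (m : Move L Q) → C (advance m i) → Sat Y (enabled m ℓ) →
                    (C (suc i) × Sat Y (fires m (just ℓ))) ⊎ (C i × Sat Y (fires m nothing))
    enabled⇒fires (read g) c s = inj₁ (c , s)
    enabled⇒fires (skip g) c s = inj₂ (c , s)

    fires⇒enabled : (m : Move L Q) →
                    (C (suc i) × Sat Y (fires m (just ℓ))) ⊎ (C i × Sat Y (fires m nothing)) →
                    C (advance m i) × Sat Y (enabled m ℓ)
    fires⇒enabled (read g) (inj₁ p) = p
    fires⇒enabled (skip g) (inj₂ p) = p

∑ : (n : ℕ) → (Fin n → ℕ) → ℕ
∑ n f = sum (tabulate f)

∑-cong : ∀ n {f g : Fin n → ℕ} → (∀ i → f i ≡ g i) → ∑ n f ≡ ∑ n g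
∑-cong zero h = refl
∑-cong (suc n) h = cong₂ _+_ (h fzero) (∑-cong n (λ i → h (fsuc i)))

∑-mono : ∀ n {f g : Fin n → ℕ} → (∀ i → f i ≤ g i) → ∑ n f ≤ ∑ n g
∑-mono zero h = z≤n
∑-mono (suc n) h = +-mono-≤ (h fzero) (∑-mono n (λ i → h (fsuc i)))

∑-split : ∀ m n (f : Fin (m + n) → ℕ) → ∑ (m + n) f ≡ ∑ m (λ i → f (i ↑ˡ n)) + ∑ n (λ j → f (m ↑ʳ j))
∑-split zero n f = refl
∑-split (suc m) n f = trans (cong (f fzero +_) (∑-split m n (λ i → f (fsuc i)))) (sym (+-assoc (f fzero) _ _))

∑-+ : ∀ n (f g : Fin n → ℕ) → ∑ n (λ i → f i + g i) ≡ ∑ n f + ∑ n g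
∑-+ zero f g = refl
∑-+ (suc n) f g = trans (cong (f fzero + g fzero +_) (∑-+ n (λ i → f (fsuc i)) (λ i → g (fsuc i))))
                        (+-+-comm (f fzero) (g fzero) _ _)
  where
  +-+-comm : ∀ a b c d → a + b + (c + d) ≡ a + c + (b + d)
  +-+-comm = solve-∀

∑-const : ∀ n c → ∑ n (λ _ → c) ≡ n * c
∑-const zero c = refl
∑-const (suc n) c = cong (c +_) (∑-const n c)

∑-*ˡ : ∀ n c (f : Fin n → ℕ) → ∑ n (λ i → c * f i) ≡ c * ∑ n f
∑-*ˡ zero c f = sym (*-zeroʳ c)
∑-*ˡ (suc n) c f = trans (cong (c * f fzero +_) (∑-*ˡ n c (λ i → f (fsuc i)))) (sym (*-distribˡ-+ c (f fzero) _))

sum-map-≤ : {X : Set} (f : X → ℕ) {B : ℕ} → (∀ x → f x ≤ B) → ∀ xs → sum (map f xs) ≤ length xs * B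
sum-map-≤ f h [] = z≤n
sum-map-≤ f h (x ∷ xs) = +-mono-≤ (h x) (sum-map-≤ f h xs)

∑-classes : {X : Set} {n : ℕ} (key : X → Fin n) (xs : List X) →
            ∑ n (λ q → length (filter (λ x → key x ≟ q) xs)) ≡ length xs
∑-classes {n = n} key [] = trans (∑-const n 0) (*-zeroʳ n)
∑-classes {n = n} key (x ∷ xs) =
  trans (∑-cong n class-of-x) (trans (∑-+ n _ _) (cong₂ _+_ (indicator (key x)) (∑-classes key xs)))
  where
  δ : ∀ {m} → Fin m → Fin m → ℕ
  δ p q = if does (p ≟ q) then 1 else 0
  class-of-x : ∀ q → length (filter (λ y → key y ≟ q) (x ∷ xs)) ≡ δ (key x) q + length (filter (λ y → key y ≟ q) xs)
  class-of-x q with does (key x ≟ q)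
  ... | true = refl
  ... | false = refl
  indicator : ∀ {m} (p : Fin m) → ∑ m (δ p) ≡ 1
  indicator {suc m} fzero = cong suc (trans (∑-const m 0) (*-zeroʳ m))
  indicator {suc m} (fsuc p) = indicator p

record Finite (X : Set) : Set where
  field
    size          : ℕ
    decode        : Fin size → X
    encode        : X → Fin size
    decode-encode : ∀ x → decode (encode x) ≡ x

  total : (X → ℕ) → ℕ
  total f = ∑ size (λ i → f (decode i))

open Finite

finite-⊤ : Finite ⊤
finite-⊤ = record { size = 1 ; decode = λ _ → tt ; encode = λ _ → fzero ; decode-encode = λ _ → refl }

finite-Fin : ∀ n → Finite (Fin n)
finite-Fin n = record { size = n ; decode = λ i → i ; encode = λ i → i ; decode-encode = λ _ → refl }

retract : {X Y : Set} (from : Y → X) (to : X → Y) → (∀ x → from (to x) ≡ x) → Finite Y → Finite X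
retract from to from-to F = record
  { size = size F ; decode = λ i → from (decode F i) ; encode = λ x → encode F (to x)
  ; decode-encode = λ x → trans (cong from (decode-encode F (to x))) (from-to x) }

module _ {X Y : Set} (F : Finite X) (G : Finite Y) where

  private
    split : Fin (size F + size G) → X ⊎ Y
    split i = [ (λ j → inj₁ (decode F j)) , (λ j → inj₂ (decode G j)) ] (splitAt (size F) i)

    split-↑ˡ : ∀ j → split (j ↑ˡ size G) ≡ inj₁ (decode F j)
    split-↑ˡ j = cong [ _ , _ ] (splitAt-↑ˡ (size F) j (size G))

    split-↑ʳ : ∀ j → split (size F ↑ʳ j) ≡ inj₂ (decode G j)
    split-↑ʳ j = cong [ _ , _ ] (splitAt-↑ʳ (size F) (size G) j)

    join : X ⊎ Y → Fin (size F + size G)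
    join = [ (λ x → encode F x ↑ˡ size G) , (λ y → size F ↑ʳ encode G y) ]

    split-join : ∀ z → split (join z) ≡ z
    split-join (inj₁ x) = trans (split-↑ˡ (encode F x)) (cong inj₁ (decode-encode F x))
    split-join (inj₂ y) = trans (split-↑ʳ (encode G y)) (cong inj₂ (decode-encode G y))

  _⊕_ : Finite (X ⊎ Y)
  _⊕_ = record { size = size F + size G ; decode = split ; encode = join ; decode-encode = split-join }

  total-⊕ : (f : X ⊎ Y → ℕ) → total _⊕_ f ≡ total F (λ x → f (inj₁ x)) + total G (λ y → f (inj₂ y))
  total-⊕ f = trans (∑-split (size F) (size G) _)
                    (cong₂ _+_ (∑-cong (size F) (λ j → cong f (split-↑ˡ j)))
                               (∑-cong (size G) (λ j → cong f (split-↑ʳ j))))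

infiniteChain : {X : Set} {R : X → X → Set} {G : X → Set} →
  (∀ x → G x → Σ X λ y → R x y × G y) → ∀ {x} → G x →
  Σ (ℕ → X) λ c → c 0 ≡ x × (∀ n → R (c n) (c (suc n))) × (∀ n → G (c n))
infiniteChain {X} {R} {G} next {x} gx = (λ n → proj₁ (walk n)) , refl , step , (λ n → proj₂ (walk n))
  where
  walk : ℕ → Σ X G
  walk zero = x , gx
  walk (suc n) = proj₁ (next _ (proj₂ (walk n))) , proj₂ (proj₂ (next _ (proj₂ (walk n))))
  step : ∀ n → R (proj₁ (walk n)) (proj₁ (walk (suc n)))
  step n = proj₁ (proj₂ (next _ (proj₂ (walk n))))

noInfiniteDescent : (f : ℕ → ℕ) → (∀ n → f (suc n) < f n) → ⊥
noInfiniteDescent f desc = descent∧wf⇒empty descent <-wellFounded (f 0) (0 , refl)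
  where
  descent : ∀ {x} → (∃ λ n → f n ≡ x) → ∃ λ y → y < x × ∃ λ n → f n ≡ y
  descent (n , refl) = f (suc n) , desc n , suc n , refl

module Construction (nAP nΣ : ℕ) where
  open LTLREG nAP nΣ

  module _ (A : NFA) where
    open NFA A

    Transition : Set
    Transition = Fin nStates × Act × Fin nStates

    leaves? : (q : Fin nStates) (t : Transition) → Dec (proj₁ t ≡ q)
    leaves? q t = proj₁ t ≟ q

    reads? : (a : Act) (t : Transition) → Dec (proj₁ (proj₂ t) ≡ a)
    reads? a t = proj₁ (proj₂ t) ≟ a

    outgoing : Fin nStates → List Transition
    outgoing q = filter (leaves? q) transitions

    outDegree : Fin nStates → ℕ
    outDegree q = length (outgoing q)

    successors : Fin nStates → Act → List (Fin nStates)
    successors q a = map (λ t → proj₂ (proj₂ t)) (filter (reads? a) (outgoing q))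

    successor⁺ : ∀ {q a q'} → (q , a , q') ∈ₗ transitions → q' ∈ₗ successors q a
    successor⁺ {q} {a} m = ∈-map⁺ _ (∈-filter⁺ (reads? a) (∈-filter⁺ (leaves? q) m refl) refl)

    successor⁻ : ∀ {q a q'} → q' ∈ₗ successors q a → (q , a , q') ∈ₗ transitions
    successor⁻ {q} {a} m with ∈-map⁻ _ m
    ... | _ , m₁ , refl with ∈-filter⁻ (reads? a) m₁
    ... | m₂ , refl with ∈-filter⁻ (leaves? q) m₂
    ... | m₃ , refl = m₃

    length-successors : ∀ q a → length (successors q a) ≤ outDegree q
    length-successors q a = ≤-trans (≤-reflexive (length-map (λ t → proj₂ (proj₂ t)) (filter (reads? a) (outgoing q))))
                                    (length-filter (reads? a) (outgoing q))

    successors-bound : ∀ q a → 1 + 2 * length (successors q a) ≤ 1 + 2 * outDegree q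
    successors-bound q a = s≤s (*-monoʳ-≤ 2 (length-successors q a))

    -- every transition leaves exactly one state
    ∑-outDegree : ∑ nStates outDegree ≡ length transitions
    ∑-outDegree = ∑-classes proj₁ transitions

    initials : List (Fin nStates)
    initials = filter (_∈? initial) (allFin nStates)

    initial⁺ : ∀ {q} → q ∈ initial → q ∈ₗ initials
    initial⁺ qI = ∈-filter⁺ (_∈? initial) (∈-allFin _) qI

    initial⁻ : ∀ {q} → q ∈ₗ initials → q ∈ initial
    initial⁻ m = proj₂ (∈-filter⁻ (_∈? initial) {xs = allFin nStates} m)

    initials-bound : 1 + 2 * length initials ≤ 1 + 2 * nStates
    initials-bound = s≤s (*-monoʳ-≤ 2 (≤-trans (length-filter (_∈? initial) (allFin nStates))
                                               (≤-reflexive (length-tabulate {n = nStates} (λ q → q)))))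

    FinalStep : Fin nStates → Act → Set
    FinalStep q a = ∃ λ r → r ∈ₗ successors q a × r ∈ final

    finalStep? : ∀ q a → Dec (FinalStep q a)
    finalStep? q a = map′ find (λ (r , m , f) → lose {P = _∈ final} m f) (any? (_∈? final) (successors q a))

    AcceptsFrom : Fin nStates → List Act → Set
    AcceptsFrom q u = ∃ λ r → r ∈ final × NFARun A q u r

    accepts-[]⁺ : ∀ {q a} → FinalStep q a → AcceptsFrom q (a ∷ [])
    accepts-[]⁺ (r , m , f) = r , f , step (successor⁻ m) done

    accepts-[]⁻ : ∀ {q a} → AcceptsFrom q (a ∷ []) → FinalStep q a
    accepts-[]⁻ (r , f , step m done) = r , successor⁺ m , f

    accepts-∷⁺ : ∀ {q a u q'} → q' ∈ₗ successors q a → AcceptsFrom q' u → AcceptsFrom q (a ∷ u)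
    accepts-∷⁺ m (r , f , run) = r , f , step (successor⁻ m) run

    accepts-∷⁻ : ∀ {q a u} → AcceptsFrom q (a ∷ u) → ∃ λ q' → q' ∈ₗ successors q a × AcceptsFrom q' u
    accepts-∷⁻ (r , f , step m run) = _ , successor⁺ m , r , f , run

  window : (ℕ → Act) → ℕ → ℕ → List Act
  window act i zero = act i ∷ []
  window act i (suc k) = act i ∷ window act (suc i) k

  map-upTo-window : ∀ (g act : ℕ → Act) i → (∀ n → g n ≡ act (n + i)) → ∀ k → map g (upTo (suc k)) ≡ window act i k
  map-upTo-window g act i h zero = cong (_∷ []) (h 0)
  map-upTo-window g act i h (suc k) = begin
    map g (upTo (suc (suc k)))                 ≡⟨ map-upTo g (suc (suc k)) ⟩
    g 0 ∷ applyUpTo (λ n → g (suc n)) (suc k)  ≡⟨ cong (g 0 ∷_) (sym (map-upTo (λ n → g (suc n)) (suc k))) ⟩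
    g 0 ∷ map (λ n → g (suc n)) (upTo (suc k)) ≡⟨ cong₂ _∷_ (h 0) (map-upTo-window _ act (suc i) shifted k) ⟩
    act i ∷ window act (suc i) k               ∎
    where
    open ≡-Reasoning
    shifted : ∀ n → g (suc n) ≡ act (n + suc i)
    shifted n = trans (h (suc n)) (cong act (sym (+-suc n i)))

  -- For predicates Pφ, Pψ on
  -- positions, UntilIn q i k says that φ U^A ψ holds from position i with
  -- the NFA in state q and ψ reached k steps later, one step at a time;
  -- ReleaseIn q i k is the dual requirement for the windows of length k+1.
  -- These step-wise forms are what the automaton states track; the lemmas
  -- relate them to the "flat" forms used in the semantics of LTL[REG].

  module Unfolding (act : ℕ → Act) (A : NFA) (Pφ Pψ : ℕ → Set) where
    open NFA A using (nStates)

    UntilIn : Fin nStates → ℕ → ℕ → Set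
    UntilIn q i zero = Pψ i × FinalStep A q (act i)
    UntilIn q i (suc k) = Pφ i × ∃ λ q' → q' ∈ₗ successors A q (act i) × UntilIn q' (suc i) k

    ReleaseIn : Fin nStates → ℕ → ℕ → Set
    ReleaseIn q i zero = ¬ FinalStep A q (act i) ⊎ Pψ i
    ReleaseIn q i (suc k) = Pφ i ⊎ (∀ q' → q' ∈ₗ successors A q (act i) → ReleaseIn q' (suc i) k)

    UntilFlat : Fin nStates → ℕ → ℕ → Set
    UntilFlat q i k = Pψ (k + i) × (∀ j → j < k → Pφ (j + i)) × AcceptsFrom A q (window act i k)

    ReleaseFlat : Fin nStates → ℕ → ℕ → Set
    ReleaseFlat q i k = ¬ AcceptsFrom A q (window act i k) ⊎ Pψ (k + i) ⊎ ∃ λ j → j < k × Pφ (j + i)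

    until⇒flat : ∀ {q} i k → UntilIn q i k → UntilFlat q i k
    until⇒flat i zero (ψ , fin) = ψ , (λ _ ()) , accepts-[]⁺ A fin
    until⇒flat i (suc k) (φ , q' , m , u) with until⇒flat (suc i) k u
    ... | ψ , φs , acc = subst Pψ (+-suc k i) ψ , φs′ , accepts-∷⁺ A m acc
      where
      φs′ : ∀ j → j < suc k → Pφ (j + i)
      φs′ zero _ = φ
      φs′ (suc j) (s≤s j<k) = subst Pφ (+-suc j i) (φs j j<k)

    flat⇒until : ∀ {q} i k → UntilFlat q i k → UntilIn q i k
    flat⇒until i zero (ψ , _ , acc) = ψ , accepts-[]⁻ A acc
    flat⇒until i (suc k) (ψ , φs , acc) with accepts-∷⁻ A acc
    ... | q' , m , acc′ = φs 0 (s≤s z≤n) , q' , m , flat⇒until (suc i) k (ψ′ , φs′ , acc′)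
      where
      ψ′ : Pψ (k + suc i)
      ψ′ = subst Pψ (sym (+-suc k i)) ψ
      φs′ : ∀ j → j < k → Pφ (j + suc i)
      φs′ j j<k = subst Pφ (sym (+-suc j i)) (φs (suc j) (s≤s j<k))

    -- Release needs excluded middle in both directions: the flat form
    -- negates acceptance, the step-wise form decides Pφ i first.
    module _ (em : ExcludedMiddle 0ℓ) where

      release⇒flat : ∀ {q} i k → ReleaseIn q i k → ReleaseFlat q i k
      release⇒flat i zero (inj₁ ¬fin) = inj₁ (λ acc → ¬fin (accepts-[]⁻ A acc))
      release⇒flat i zero (inj₂ ψ) = inj₂ (inj₁ ψ)
      release⇒flat i (suc k) (inj₁ φ) = inj₂ (inj₂ (0 , s≤s z≤n , φ))
      release⇒flat {q} i (suc k) (inj₂ next) with em {AcceptsFrom A q (window act i (suc k))}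
      ... | no ¬acc = inj₁ ¬acc
      ... | yes acc with accepts-∷⁻ A acc
      ...   | q' , m , acc′ with release⇒flat (suc i) k (next q' m)
      ...     | inj₁ ¬acc′ = ⊥-elim (¬acc′ acc′)
      ...     | inj₂ (inj₁ ψ) = inj₂ (inj₁ (subst Pψ (+-suc k i) ψ))
      ...     | inj₂ (inj₂ (j , j<k , φ)) = inj₂ (inj₂ (suc j , s≤s j<k , subst Pφ (+-suc j i) φ))

      flat⇒release : ∀ {q} i k → ReleaseFlat q i k → ReleaseIn q i k
      flat⇒release i zero (inj₁ ¬acc) = inj₁ (λ fin → ¬acc (accepts-[]⁺ A fin))
      flat⇒release i zero (inj₂ (inj₁ ψ)) = inj₂ ψ
      flat⇒release {q} i (suc k) r with em {Pφ i}
      ... | yes φ = inj₁ φ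
      ... | no ¬φ = inj₂ λ q' m → flat⇒release (suc i) k (shift q' m r)
        where
        shift : ∀ q' → q' ∈ₗ successors A q (act i) → ReleaseFlat q i (suc k) → ReleaseFlat q' (suc i) k
        shift q' m (inj₁ ¬acc) = inj₁ (λ acc′ → ¬acc (accepts-∷⁺ A m acc′))
        shift q' m (inj₂ (inj₁ ψ)) = inj₂ (inj₁ (subst Pψ (sym (+-suc k i)) ψ))
        shift q' m (inj₂ (inj₂ (zero , _ , φ))) = ⊥-elim (¬φ φ)
        shift q' m (inj₂ (inj₂ (suc j , s≤s j<k , φ))) = inj₂ (inj₂ (j , j<k , subst Pφ (sym (+-suc j i)) φ))

  -- Its states are the subformulae of Φ
  -- (state 'self' of a subformula asserts it at the current position) and,
  -- for every until/release over an NFA with states Q, three copies of Q: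
  --   uAt q   : φ U ψ still holds here, the NFA being in state q,
  --   uEnd q  : the current action takes q into a final state,
  --   uNext q : the current action takes q to some q' with uAt q' next,
  -- and dually rAt, rEnd, rNext for release.

  data Child : Formula → Formula → Set where
    c∧l : ∀ {φ ψ} → Child φ (φ ∧ᶠ ψ)
    c∧r : ∀ {φ ψ} → Child ψ (φ ∧ᶠ ψ)
    c∨l : ∀ {φ ψ} → Child φ (φ ∨ᶠ ψ)
    c∨r : ∀ {φ ψ} → Child ψ (φ ∨ᶠ ψ)
    cUl : ∀ {A φ ψ} → Child φ (U[ A ] φ ψ)
    cUr : ∀ {A φ ψ} → Child ψ (U[ A ] φ ψ)
    cRl : ∀ {A φ ψ} → Child φ (R[ A ] φ ψ)
    cRr : ∀ {A φ ψ} → Child ψ (R[ A ] φ ψ)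

  data State : Formula → Set where
    self : ∀ {φ} → State φ
    sub : ∀ {φ χ} → Child φ χ → State φ → State χ
    uAt uEnd uNext : ∀ {A φ ψ} → Fin (NFA.nStates A) → State (U[ A ] φ ψ)
    rAt rEnd rNext : ∀ {A φ ψ} → Fin (NFA.nStates A) → State (R[ A ] φ ψ)

  move : ∀ {φ} → State φ → Move Letter (State φ)
  move (sub c s) = mapMove (sub c) (move s)
  move {ap p} self = read λ ℓ → truth (p ∈? proj₁ ℓ)
  move {nap p} self = read λ ℓ → truth (¬? (p ∈? proj₁ ℓ))
  move {φ ∧ᶠ ψ} self = skip (atom (sub c∧l self) ∧ᵇ atom (sub c∧r self))
  move {φ ∨ᶠ ψ} self = skip (atom (sub c∨l self) ∨ᵇ atom (sub c∨r self))
  move {U[ A ] φ ψ} self = skip (anyOf uAt (initials A))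
  move (uAt q) = skip ((atom (sub cUr self) ∧ᵇ atom (uEnd q)) ∨ᵇ (atom (sub cUl self) ∧ᵇ atom (uNext q)))
  move (uEnd {A} q) = read λ ℓ → truth (finalStep? A q (proj₂ ℓ))
  move (uNext {A} q) = read λ ℓ → anyOf uAt (successors A q (proj₂ ℓ))
  move {R[ A ] φ ψ} self = skip (allOf rAt (initials A))
  move (rAt q) = skip ((atom (sub cRr self) ∨ᵇ atom (rEnd q)) ∧ᵇ (atom (sub cRl self) ∨ᵇ atom (rNext q)))
  move (rEnd {A} q) = read λ ℓ → truth (¬? (finalStep? A q (proj₂ ℓ)))
  move (rNext {A} q) = read λ ℓ → allOf rAt (successors A q (proj₂ ℓ))

  -- Only the until-states uAt/uNext are non-accepting: an until may not be postponed forever.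
  accepting : ∀ {φ} → State φ → Bool
  accepting (sub c s) = accepting s
  accepting (uAt _) = false
  accepting (uNext _) = false
  accepting _ = true

  weight : ∀ {φ} → State φ → ℕ
  weight (sub c s) = weight s
  weight {ap _} self = 1
  weight {nap _} self = 1
  weight {_ ∧ᶠ _} self = 3
  weight {_ ∨ᶠ _} self = 3
  weight {U[ A ] _ _} self = 1 + 2 * NFA.nStates A
  weight {R[ A ] _ _} self = 1 + 2 * NFA.nStates A
  weight (uAt _) = 7
  weight (uEnd _) = 1
  weight (uNext {A} q) = 1 + 2 * outDegree A q
  weight (rAt _) = 7
  weight (rEnd _) = 1
  weight (rNext {A} q) = 1 + 2 * outDegree A q

  weight-pos : ∀ {φ} (s : State φ) → 1 ≤ weight s
  weight-pos (sub c s) = weight-pos s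
  weight-pos {ap _} self = s≤s z≤n
  weight-pos {nap _} self = s≤s z≤n
  weight-pos {_ ∧ᶠ _} self = s≤s z≤n
  weight-pos {_ ∨ᶠ _} self = s≤s z≤n
  weight-pos {U[ A ] _ _} self = s≤s z≤n
  weight-pos {R[ A ] _ _} self = s≤s z≤n
  weight-pos (uAt _) = s≤s z≤n
  weight-pos (uEnd _) = s≤s z≤n
  weight-pos (uNext _) = s≤s z≤n
  weight-pos (rAt _) = s≤s z≤n
  weight-pos (rEnd _) = s≤s z≤n
  weight-pos (rNext _) = s≤s z≤n

  move-bounded : ∀ {φ} (s : State φ) → Bounded (move s) (weight s)
  move-bounded (sub c s) = Bounded-map (sub c) (move s) (move-bounded s)
  move-bounded {ap p} self ℓ = ≤-reflexive (pbfSize-truth (p ∈? proj₁ ℓ))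
  move-bounded {nap p} self ℓ = ≤-reflexive (pbfSize-truth (¬? (p ∈? proj₁ ℓ)))
  move-bounded {_ ∧ᶠ _} self = ≤-refl
  move-bounded {_ ∨ᶠ _} self = ≤-refl
  move-bounded {U[ A ] _ _} self = ≤-trans (≤-reflexive (pbfSize-anyOf uAt (initials A))) (initials-bound A)
  move-bounded {R[ A ] _ _} self = ≤-trans (≤-reflexive (pbfSize-allOf rAt (initials A))) (initials-bound A)
  move-bounded (uAt _) = ≤-refl
  move-bounded (uEnd {A} q) ℓ = ≤-reflexive (pbfSize-truth (finalStep? A q (proj₂ ℓ)))
  move-bounded (uNext {A} q) ℓ = ≤-trans (≤-reflexive (pbfSize-anyOf uAt (successors A q (proj₂ ℓ)))) (successors-bound A q (proj₂ ℓ))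
  move-bounded (rAt _) = ≤-refl
  move-bounded (rEnd {A} q) ℓ = ≤-reflexive (pbfSize-truth (¬? (finalStep? A q (proj₂ ℓ))))
  move-bounded (rNext {A} q) ℓ = ≤-trans (≤-reflexive (pbfSize-allOf rAt (successors A q (proj₂ ℓ)))) (successors-bound A q (proj₂ ℓ))

  Code : Formula → Set
  Code (ap _) = ⊤
  Code (nap _) = ⊤
  Code (φ ∧ᶠ ψ) = ⊤ ⊎ (State φ ⊎ State ψ)
  Code (φ ∨ᶠ ψ) = ⊤ ⊎ (State φ ⊎ State ψ)
  Code (U[ A ] φ ψ) = ⊤ ⊎ ((State φ ⊎ State ψ) ⊎ (Fin (NFA.nStates A) ⊎ (Fin (NFA.nStates A) ⊎ Fin (NFA.nStates A))))
  Code (R[ A ] φ ψ) = ⊤ ⊎ ((State φ ⊎ State ψ) ⊎ (Fin (NFA.nStates A) ⊎ (Fin (NFA.nStates A) ⊎ Fin (NFA.nStates A))))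

  toCode : ∀ {φ} → State φ → Code φ
  toCode {ap _} self = tt
  toCode {nap _} self = tt
  toCode {_ ∧ᶠ _} self = inj₁ tt
  toCode {_ ∨ᶠ _} self = inj₁ tt
  toCode {U[ _ ] _ _} self = inj₁ tt
  toCode {R[ _ ] _ _} self = inj₁ tt
  toCode (sub c∧l s) = inj₂ (inj₁ s)
  toCode (sub c∧r s) = inj₂ (inj₂ s)
  toCode (sub c∨l s) = inj₂ (inj₁ s)
  toCode (sub c∨r s) = inj₂ (inj₂ s)
  toCode (sub cUl s) = inj₂ (inj₁ (inj₁ s))
  toCode (sub cUr s) = inj₂ (inj₁ (inj₂ s))
  toCode (sub cRl s) = inj₂ (inj₁ (inj₁ s))
  toCode (sub cRr s) = inj₂ (inj₁ (inj₂ s))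
  toCode (uAt q) = inj₂ (inj₂ (inj₁ q))
  toCode (uEnd q) = inj₂ (inj₂ (inj₂ (inj₁ q)))
  toCode (uNext q) = inj₂ (inj₂ (inj₂ (inj₂ q)))
  toCode (rAt q) = inj₂ (inj₂ (inj₁ q))
  toCode (rEnd q) = inj₂ (inj₂ (inj₂ (inj₁ q)))
  toCode (rNext q) = inj₂ (inj₂ (inj₂ (inj₂ q)))

  fromCode : ∀ {φ} → Code φ → State φ
  fromCode {ap _} _ = self
  fromCode {nap _} _ = self
  fromCode {_ ∧ᶠ _} (inj₁ _) = self
  fromCode {_ ∧ᶠ _} (inj₂ (inj₁ s)) = sub c∧l s
  fromCode {_ ∧ᶠ _} (inj₂ (inj₂ s)) = sub c∧r s
  fromCode {_ ∨ᶠ _} (inj₁ _) = self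
  fromCode {_ ∨ᶠ _} (inj₂ (inj₁ s)) = sub c∨l s
  fromCode {_ ∨ᶠ _} (inj₂ (inj₂ s)) = sub c∨r s
  fromCode {U[ _ ] _ _} (inj₁ _) = self
  fromCode {U[ _ ] _ _} (inj₂ (inj₁ (inj₁ s))) = sub cUl s
  fromCode {U[ _ ] _ _} (inj₂ (inj₁ (inj₂ s))) = sub cUr s
  fromCode {U[ _ ] _ _} (inj₂ (inj₂ (inj₁ q))) = uAt q
  fromCode {U[ _ ] _ _} (inj₂ (inj₂ (inj₂ (inj₁ q)))) = uEnd q
  fromCode {U[ _ ] _ _} (inj₂ (inj₂ (inj₂ (inj₂ q)))) = uNext q
  fromCode {R[ _ ] _ _} (inj₁ _) = self
  fromCode {R[ _ ] _ _} (inj₂ (inj₁ (inj₁ s))) = sub cRl s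
  fromCode {R[ _ ] _ _} (inj₂ (inj₁ (inj₂ s))) = sub cRr s
  fromCode {R[ _ ] _ _} (inj₂ (inj₂ (inj₁ q))) = rAt q
  fromCode {R[ _ ] _ _} (inj₂ (inj₂ (inj₂ (inj₁ q)))) = rEnd q
  fromCode {R[ _ ] _ _} (inj₂ (inj₂ (inj₂ (inj₂ q)))) = rNext q

  fromCode-toCode : ∀ {φ} (s : State φ) → fromCode (toCode s) ≡ s
  fromCode-toCode {ap _} self = refl
  fromCode-toCode {nap _} self = refl
  fromCode-toCode {_ ∧ᶠ _} self = refl
  fromCode-toCode {_ ∨ᶠ _} self = refl
  fromCode-toCode {U[ _ ] _ _} self = refl
  fromCode-toCode {R[ _ ] _ _} self = refl
  fromCode-toCode (sub c∧l s) = refl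
  fromCode-toCode (sub c∧r s) = refl
  fromCode-toCode (sub c∨l s) = refl
  fromCode-toCode (sub c∨r s) = refl
  fromCode-toCode (sub cUl s) = refl
  fromCode-toCode (sub cUr s) = refl
  fromCode-toCode (sub cRl s) = refl
  fromCode-toCode (sub cRr s) = refl
  fromCode-toCode (uAt q) = refl
  fromCode-toCode (uEnd q) = refl
  fromCode-toCode (uNext q) = refl
  fromCode-toCode (rAt q) = refl
  fromCode-toCode (rEnd q) = refl
  fromCode-toCode (rNext q) = refl

  finiteState : ∀ φ → Finite (State φ)
  finiteCode : ∀ φ → Finite (Code φ)
  finiteState φ = retract fromCode toCode fromCode-toCode (finiteCode φ)
  finiteCode (ap _) = finite-⊤
  finiteCode (nap _) = finite-⊤
  finiteCode (φ ∧ᶠ ψ) = finite-⊤ ⊕ (finiteState φ ⊕ finiteState ψ)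
  finiteCode (φ ∨ᶠ ψ) = finite-⊤ ⊕ (finiteState φ ⊕ finiteState ψ)
  finiteCode (U[ A ] φ ψ) = finite-⊤ ⊕ ((finiteState φ ⊕ finiteState ψ) ⊕ (finite-Fin n ⊕ (finite-Fin n ⊕ finite-Fin n)))
    where n = NFA.nStates A
  finiteCode (R[ A ] φ ψ) = finite-⊤ ⊕ ((finiteState φ ⊕ finiteState ψ) ⊕ (finite-Fin n ⊕ (finite-Fin n ⊕ finite-Fin n)))
    where n = NFA.nStates A

  aut : Formula → ABA
  aut Φ = record
    { nQ = size S
    ; δ  = λ f l → mapPBF (encode S) (fires (move (decode S f)) l)
    ; q₀ = encode S self
    ; F  = Vec.tabulate (λ f → accepting (decode S f)) }
    where S = finiteState Φ

  module _ (Φ : Formula) where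
    private S = finiteState Φ

    δ-encode : ∀ (s : State Φ) l → ABA.δ (aut Φ) (encode S s) l ≡ mapPBF (encode S) (fires (move s) l)
    δ-encode s l = cong (λ s′ → mapPBF (encode S) (fires (move s′) l)) (decode-encode S s)

    accepting⇒∈F : ∀ (s : State Φ) → accepting s ≡ true → encode S s ∈ ABA.F (aut Φ)
    accepting⇒∈F s acc = lookup⇒[]= (encode S s) _
      (trans (lookup∘tabulate (λ f → accepting (decode S f)) (encode S s)) (trans (cong accepting (decode-encode S s)) acc))

    ∈F⇒accepting : ∀ f → f ∈ ABA.F (aut Φ) → accepting (decode S f) ≡ true
    ∈F⇒accepting f m = trans (sym (lookup∘tabulate (λ f′ → accepting (decode S f′)) f)) ([]=⇒lookup m)

  module Semantics (w : Word) where

    act : ℕ → Act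
    act i = proj₂ (w i)

    Holds : ℕ → Formula → Set
    Holds i (ap p) = p ∈ proj₁ (w i)
    Holds i (nap p) = ¬ (p ∈ proj₁ (w i))
    Holds i (φ ∧ᶠ ψ) = Holds i φ × Holds i ψ
    Holds i (φ ∨ᶠ ψ) = Holds i φ ⊎ Holds i ψ
    Holds i (U[ A ] φ ψ) =
      ∃ λ q → q ∈ NFA.initial A × ∃ (Unfolding.UntilIn act A (λ j → Holds j φ) (λ j → Holds j ψ) q i)
    Holds i (R[ A ] φ ψ) =
      ∀ q → q ∈ NFA.initial A → ∀ k → Unfolding.ReleaseIn act A (λ j → Holds j φ) (λ j → Holds j ψ) q i k

    module Temporal (A : NFA) (φ ψ : Formula) = Unfolding act A (λ j → Holds j φ) (λ j → Holds j ψ)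
    open Temporal

    StateHolds : ∀ {φ} → State φ → ℕ → Set
    StateHolds {φ} self i = Holds i φ
    StateHolds (sub c s) i = StateHolds s i
    StateHolds (uAt {A} {φ} {ψ} q) i = ∃ (UntilIn A φ ψ q i)
    StateHolds (uEnd {A} q) i = FinalStep A q (act i)
    StateHolds (uNext {A} {φ} {ψ} q) i = ∃ λ q' → q' ∈ₗ successors A q (act i) × ∃ (UntilIn A φ ψ q' (suc i))
    StateHolds (rAt {A} {φ} {ψ} q) i = ∀ k → ReleaseIn A φ ψ q i k
    StateHolds (rEnd {A} q) i = ¬ FinalStep A q (act i)
    StateHolds (rNext {A} {φ} {ψ} q) i = ∀ q' → q' ∈ₗ successors A q (act i) → ∀ k → ReleaseIn A φ ψ q' (suc i) k

    Reads : ∀ {K} → Path K → ℕ → Set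
    Reads π i = ∀ n → trace π n ≡ w (n + i)

    reads-suffix : ∀ {K} (π : Path K) {i} → Reads π i → ∀ m → Reads (suffix π m) (m + i)
    reads-suffix π {i} h m n = trans (h (n + m)) (cong w (+-assoc n m i))

    actions-window : ∀ {K} {π : Path K} {i} → Reads π i → ∀ k → actions π k ≡ window act i k
    actions-window {π = π} {i} h = map-upTo-window (Path.act π) act i (λ n → cong proj₂ (h n))

    module _ {K : Kripke} (π : Path K) {i : ℕ} (h : Reads π i) {A : NFA} {φ ψ : Formula}
             (ihφ : ∀ m → suffix π m ⊨ φ ⇔ Holds (m + i) φ) (ihψ : ∀ m → suffix π m ⊨ ψ ⇔ Holds (m + i) ψ) where

      run-window : ∀ {q r} k → NFARun A q (actions π k) r → NFARun A q (window act i k) r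
      run-window {q} {r} k = subst (λ u → NFARun A q u r) (actions-window {π = π} h k)

      run-actions : ∀ {q r} k → NFARun A q (window act i k) r → NFARun A q (actions π k) r
      run-actions {q} {r} k = subst (λ u → NFARun A q u r) (sym (actions-window {π = π} h k))

      ⊨U⇔ : π ⊨ U[ A ] φ ψ ⇔ Holds i (U[ A ] φ ψ)
      ⊨U⇔ = mk⇔ to from
        where
        to : π ⊨ U[ A ] φ ψ → Holds i (U[ A ] φ ψ)
        to (k , sψ , sφ , q₀ , r , qI , rF , run) =
          q₀ , qI , k , flat⇒until A φ ψ i k (fwd (ihψ k) sψ , (λ j j<k → fwd (ihφ j) (sφ j j<k)) , r , rF , run-window k run)
        from : Holds i (U[ A ] φ ψ) → π ⊨ U[ A ] φ ψ
        from (q₀ , qI , k , u) with until⇒flat A φ ψ i k u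
        ... | ψk , φs , r , rF , run = k , bwd (ihψ k) ψk , (λ j j<k → bwd (ihφ j) (φs j j<k)) , q₀ , r , qI , rF , run-actions k run

      ⊨R⇔ : ExcludedMiddle 0ℓ → π ⊨ R[ A ] φ ψ ⇔ Holds i (R[ A ] φ ψ)
      ⊨R⇔ em = mk⇔ to from
        where
        to : π ⊨ R[ A ] φ ψ → Holds i (R[ A ] φ ψ)
        to s q qI k = flat⇒release A φ ψ em i k (flat (s k))
          where
          flat : ¬ NFAAccepts A (actions π k) ⊎ (suffix π k ⊨ ψ) ⊎ (∃ λ j → j < k × suffix π j ⊨ φ) →
                 ReleaseFlat A φ ψ q i k
          flat (inj₁ ¬acc) = inj₁ (λ (r , rF , run) → ¬acc (q , r , qI , rF , run-actions k run))
          flat (inj₂ (inj₁ sψ)) = inj₂ (inj₁ (fwd (ihψ k) sψ))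
          flat (inj₂ (inj₂ (j , j<k , sφ))) = inj₂ (inj₂ (j , j<k , fwd (ihφ j) sφ))
        from : Holds i (R[ A ] φ ψ) → π ⊨ R[ A ] φ ψ
        from p k with em {NFAAccepts A (actions π k)}
        ... | no ¬acc = inj₁ ¬acc
        ... | yes (q , r , qI , rF , run) with release⇒flat A φ ψ em i k (p q qI k)
        ...   | inj₁ ¬acc = ⊥-elim (¬acc (r , rF , run-window k run))
        ...   | inj₂ (inj₁ ψk) = inj₂ (inj₁ (bwd (ihψ k) ψk))
        ...   | inj₂ (inj₂ (j , j<k , φj)) = inj₂ (inj₂ (j , j<k , bwd (ihφ j) φj))

    ⊨⇔Holds : ExcludedMiddle 0ℓ → ∀ φ {K} (π : Path K) {i} → Reads π i → π ⊨ φ ⇔ Holds i φ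
    ⊨⇔Holds em (ap p) π h = mk⇔ (subst (p ∈_) (cong proj₁ (h 0))) (subst (p ∈_) (sym (cong proj₁ (h 0))))
    ⊨⇔Holds em (nap p) π h = mk⇔ (λ s m → s (subst (p ∈_) (sym (cong proj₁ (h 0))) m))
                                 (λ s m → s (subst (p ∈_) (cong proj₁ (h 0)) m))
    ⊨⇔Holds em (φ ∧ᶠ ψ) π h = mk⇔ (Product.map (fwd (⊨⇔Holds em φ π h)) (fwd (⊨⇔Holds em ψ π h)))
                                  (Product.map (bwd (⊨⇔Holds em φ π h)) (bwd (⊨⇔Holds em ψ π h)))
    ⊨⇔Holds em (φ ∨ᶠ ψ) π h = mk⇔ (Sum.map (fwd (⊨⇔Holds em φ π h)) (fwd (⊨⇔Holds em ψ π h)))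
                                  (Sum.map (bwd (⊨⇔Holds em φ π h)) (bwd (⊨⇔Holds em ψ π h)))
    ⊨⇔Holds em (U[ A ] φ ψ) π h =
      ⊨U⇔ π h (λ m → ⊨⇔Holds em φ (suffix π m) (reads-suffix π h m)) (λ m → ⊨⇔Holds em ψ (suffix π m) (reads-suffix π h m))
    ⊨⇔Holds em (R[ A ] φ ψ) π h =
      ⊨R⇔ π h (λ m → ⊨⇔Holds em φ (suffix π m) (reads-suffix π h m)) (λ m → ⊨⇔Holds em ψ (suffix π m) (reads-suffix π h m)) em

    -- w is the trace of the path through the word itself, so L(φ) ∋ w iff φ holds at 0.
    wordKripke : Kripke
    wordKripke = record { S = ℕ ; trans = λ _ _ _ → ⊤ ; label = λ i → proj₁ (w i) }

    wordPath : Path wordKripke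
    wordPath = record { state = λ i → i ; act = act ; valid = λ _ → tt }

    language⇔Holds : ExcludedMiddle 0ℓ → ∀ φ → Lφ φ w ⇔ Holds 0 φ
    language⇔Holds em φ = mk⇔
      (λ (K , π , tr , s) → fwd (⊨⇔Holds em φ π (λ n → trans (tr n) (at0 n))) s)
      (λ h → wordKripke , wordPath , (λ _ → refl) , bwd (⊨⇔Holds em φ wordPath at0) h)
      where
      at0 : ∀ n → w n ≡ w (n + 0)
      at0 n = cong w (sym (+-identityʳ n))

    -- The run tree has as nodes all true assertions (s, i);
    -- a pending until carries its distance k to fulfilment, which is the
    -- rank that strictly drops between consecutive non-accepting nodes.

    rank : ∀ {φ} (s : State φ) {i} → StateHolds s i → ℕ
    rank (sub c s) d = rank s d
    rank (uAt q) (k , _) = k + k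
    rank (uNext q) (_ , _ , k , _) = suc (k + k)
    rank _ _ = 0

    Descends : ∀ {φ} (s : State φ) {i} → StateHolds s i → (t : State φ) {j : ℕ} → StateHolds t j → Set
    Descends s d t d′ = accepting s ≡ false → accepting t ≡ false → rank t d′ < rank s d

    progress : ExcludedMiddle 0ℓ → ∀ {φ} (s : State φ) i (d : StateHolds s i) →
               Sat (λ t → Σ (StateHolds t (advance (move s) i)) (Descends s d t)) (enabled (move s) (w i))
    progress em (sub c s) i d with move s | progress em s i d
    ... | read f | p = Sat-map⁺ (sub c) (f (w i)) p
    ... | skip g | p = Sat-map⁺ (sub c) g p
    progress em {ap p} self i d = Sat-truth⁺ (p ∈? proj₁ (w i)) d
    progress em {nap p} self i d = Sat-truth⁺ (¬? (p ∈? proj₁ (w i))) d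
    progress em {φ ∧ᶠ ψ} self i (dφ , dψ) = (dφ , λ ()) , (dψ , λ ())
    progress em {φ ∨ᶠ ψ} self i (inj₁ dφ) = inj₁ (dφ , λ ())
    progress em {φ ∨ᶠ ψ} self i (inj₂ dψ) = inj₂ (dψ , λ ())
    progress em {U[ A ] φ ψ} self i (q , qI , u) = Sat-anyOf⁺ uAt (initial⁺ A qI) (u , λ ())
    progress em {R[ A ] φ ψ} self i d = Sat-allOf⁺ rAt (initials A) (λ q m → d q (initial⁻ A m) , λ ())
    progress em (uAt q) i (zero , dψ , fin) = inj₁ ((dψ , λ _ ()) , (fin , λ _ ()))
    progress em (uAt q) i (suc k , dφ , q′ , m , u) =
      inj₂ ((dφ , λ _ ()) , ((q′ , m , k , u) , λ _ _ → s≤s (≤-reflexive (sym (+-suc k k)))))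
    progress em (uEnd {A} q) i d = Sat-truth⁺ (finalStep? A q (act i)) d
    progress em (uNext q) i (q′ , m , k , u) = Sat-anyOf⁺ uAt m ((k , u) , λ _ _ → n<1+n (k + k))
    progress em (rAt {A} {φ} {ψ} q) i d = now , later
      where
      Next : State (R[ A ] φ ψ) → Set
      Next t = Σ (StateHolds t i) (Descends (rAt q) d t)
      now : Sat Next (atom (sub cRr self) ∨ᵇ atom (rEnd q))
      now with d 0
      ... | inj₁ ¬fin = inj₂ (¬fin , λ ())
      ... | inj₂ dψ = inj₁ (dψ , λ ())
      later : Sat Next (atom (sub cRl self) ∨ᵇ atom (rNext q))
      later with em {Holds i φ}
      ... | yes dφ = inj₁ (dφ , λ ())
      ... | no ¬dφ = inj₂ ((λ q′ m k → [ (λ dφ → ⊥-elim (¬dφ dφ)) , (λ next → next q′ m) ] (d (suc k))) , λ ())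
    progress em (rEnd {A} q) i d = Sat-truth⁺ (¬? (finalStep? A q (act i))) d
    progress em (rNext {A} q) i d = Sat-allOf⁺ rAt (successors A q (act i)) (λ q′ m → d q′ m , λ ())

    completeness : ExcludedMiddle 0ℓ → ∀ Φ → Holds 0 Φ → Run (aut Φ) w
    completeness em Φ h = record
      { Node = Node ; root = self , 0 , h ; nstate = λ x → encode S (proj₁ x) ; pos = λ x → proj₁ (proj₂ x)
      ; child = child ; rootState = refl ; rootPos = refl ; consistent = consistent ; accepting = accepting-branch }
      where
      S = finiteState Φ

      Node : Set
      Node = Σ (State Φ) λ s → Σ ℕ (StateHolds s)

      child : Node → Node → Set
      child (s , i , d) (t , j , d′) = j ≡ advance (move s) i × Descends s d t d′

      consistent : ∀ x → _
      consistent x@(s , i , d) =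
        Sum.map (Product.map₂ (toδ (just (w i)))) (Product.map₂ (toδ nothing))
          (enabled⇒fires {C = Positioned} (move s) (λ y c → proj₁ c) (Sat-mono witness (enabled (move s) (w i)) (progress em s i d)))
        where
        Y : Fin (size S) → Set
        Y f = Σ Node λ y → child x y × encode S (proj₁ y) ≡ f
        Positioned : ℕ → Set
        Positioned j = ∀ y → child x y → proj₁ (proj₂ y) ≡ j
        witness : ∀ t → Σ (StateHolds t (advance (move s) i)) (Descends s d t) → Y (encode S t)
        witness t (d′ , desc) = (t , advance (move s) i , d′) , (refl , desc) , refl
        toδ : ∀ l → Sat (λ t → Y (encode S t)) (fires (move s) l) → Sat Y (ABA.δ (aut Φ) (encode S s) l)
        toδ l sat = subst (Sat Y) (sym (δ-encode Φ s l)) (Sat-map⁺ (encode S) (fires (move s) l) sat)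

      rank′ : Node → ℕ
      rank′ (s , _ , d) = rank s d

      accepting-branch : ∀ (b : ℕ → Node) → b 0 ≡ (self , 0 , h) → (∀ k → child (b k) (b (suc k))) →
                         ∀ k → ∃ λ m → k ≤ m × encode S (proj₁ (b m)) ∈ ABA.F (aut Φ)
      accepting-branch b _ chain k with em {∃ λ m → k ≤ m × encode S (proj₁ (b m)) ∈ ABA.F (aut Φ)}
      ... | yes visit = visit
      ... | no never = ⊥-elim (noInfiniteDescent (λ n → rank′ (b (n + k))) (λ n → proj₂ (chain (n + k)) (pending n) (pending (suc n))))
        where
        pending : ∀ n → accepting (proj₁ (b (n + k))) ≡ false
        pending n with accepting (proj₁ (b (n + k))) in acc
        ... | true = ⊥-elim (never (n + k , m≤n+m k n , accepting⇒∈F Φ _ acc))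
        ... | false = refl

    -- In an accepting run every node reachable from the root
    -- asserts something true.  The proof is by induction on the subformula
    -- a node's state belongs to; within one until, a false pending
    -- obligation would produce an infinite branch avoiding F, and within
    -- one release the length of the NFA window is the induction parameter.

    module Soundness (em : ExcludedMiddle 0ℓ) (Φ : Formula) (r : Run (aut Φ) w) where
      open Run r renaming (accepting to branches-accept)
      private S = finiteState Φ

      st : Node → State Φ
      st x = decode S (nstate x)

      data Reach : Node → Set where
        start : Reach root
        _▸_ : ∀ {x y} → Reach x → child x y → Reach y

      depth : ∀ {x} → Reach x → ℕ
      depth start = 0
      depth (ρ ▸ _) = suc (depth ρ)

      _◂_ : Node → (ℕ → Node) → ℕ → Node
      (x ◂ c) zero = x
      (x ◂ c) (suc n) = c n

      branchThrough : ∀ {x} (ρ : Reach x) (c : ℕ → Node) → c 0 ≡ x → (∀ n → child (c n) (c (suc n))) →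
        Σ (ℕ → Node) λ b → b 0 ≡ root × (∀ n → child (b n) (b (suc n))) × (∀ n → b (depth ρ + n) ≡ c n)
      branchThrough start c c0 chain = c , c0 , chain , λ _ → refl
      branchThrough (_▸_ {x} ρ e) c c0 chain with branchThrough ρ (x ◂ c) refl chain′
        where
        chain′ : ∀ n → child ((x ◂ c) n) ((x ◂ c) (suc n))
        chain′ zero = subst (child x) (sym c0) e
        chain′ (suc n) = chain n
      ... | b , b0 , bchain , offset = b , b0 , bchain , λ n → trans (cong b (sym (+-suc (depth ρ) n))) (offset (suc n))

      no-pending-chain : ∀ {x} → Reach x → (c : ℕ → Node) → c 0 ≡ x → (∀ n → child (c n) (c (suc n))) →
                         (∀ n → accepting (st (c n)) ≡ false) → ⊥
      no-pending-chain ρ c c0 chain pending with branchThrough ρ c c0 chain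
      ... | b , b0 , bchain , offset with branches-accept b b0 bchain (depth ρ)
      ...   | m , d≤m , inF with trans (sym (pending (m ∸ depth ρ)))
                                     (trans (cong (λ y → accepting (st y)) (sym (trans (cong b (sym (m+[n∸m]≡n d≤m))) (offset _))))
                                            (∈F⇒accepting Φ (nstate (b m)) inF))
      ...     | ()

      Respects : {Q : Set} → Node → Move Letter Q → (Q → Set) → Set
      Respects x m Y = (∀ y → child x y → pos y ≡ advance m (pos x)) × Sat Y (enabled m (w (pos x)))

      Respects-map⁻ : ∀ {Q R : Set} {x Y} (f : Q → R) (m : Move Letter Q) → Respects x (mapMove f m) Y → Respects x m (λ q → Y (f q))
      Respects-map⁻ f (read g) (p , s) = p , Sat-map⁻ f (g _) s
      Respects-map⁻ f (skip g) (p , s) = p , Sat-map⁻ f g s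

      data Ctx : Formula → Set where
        top : Ctx Φ
        into : ∀ {φ χ} → Child φ χ → Ctx χ → Ctx φ

      embed : ∀ {φ} → Ctx φ → State φ → State Φ
      embed top s = s
      embed (into c k) s = embed k (sub c s)

      accepting-embed : ∀ {φ} (k : Ctx φ) (s : State φ) → accepting (embed k s) ≡ accepting s
      accepting-embed top s = refl
      accepting-embed (into c k) s = accepting-embed k (sub c s)

      record Witness {φ} (x : Node) (k : Ctx φ) (t : State φ) : Set where
        constructor witness
        field
          node     : Node
          is-child : child x node
          in-state : st node ≡ embed k t

      respects : ∀ x → Respects x (move (st x)) (Witness x top)
      respects x = Product.map₂ (Sat-mono decoded (enabled m (w (pos x))))
                                (fires⇒enabled {C = Positioned} m (Sum.map (Product.map₂ (undo _)) (Product.map₂ (undo _)) (consistent x)))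
        where
        m = move (st x)
        Positioned : ℕ → Set
        Positioned j = ∀ y → child x y → pos y ≡ j
        Coded : Fin (size S) → Set
        Coded f = Σ Node λ y → child x y × nstate y ≡ f
        undo : ∀ l → Sat Coded (mapPBF (encode S) (fires m l)) → Sat (λ t → Coded (encode S t)) (fires m l)
        undo l = Sat-map⁻ (encode S) (fires m l)
        decoded : ∀ t → Coded (encode S t) → Witness x top t
        decoded t (y , c , e) = witness y c (trans (cong (decode S) e) (decode-encode S t))

      respects-at : ∀ {φ} (k : Ctx φ) (s : State φ) {x} → st x ≡ embed k s → Respects x (move s) (Witness x k)
      respects-at k s {x} e = lower k s (subst (λ s′ → Respects x (move s′) (Witness x top)) e (respects x))
        where
        lower : ∀ {φ} (k : Ctx φ) (s : State φ) → Respects x (move (embed k s)) (Witness x top) → Respects x (move s) (Witness x k)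
        lower top s p = p
        lower (into c k) s p = Product.map₂ (Sat-mono (λ _ (witness y c′ e′) → witness y c′ e′) (enabled (move s) (w (pos x))))
                                            (Respects-map⁻ (sub c) (move s) (lower k (sub c s) p))

      Truthful : ∀ {φ} → Ctx φ → State φ → Set
      Truthful k s = ∀ x → Reach x → st x ≡ embed k s → StateHolds s (pos x)

      Sound : Formula → Set
      Sound φ = ∀ (k : Ctx φ) s → Truthful k s

      atChild : ∀ {φ} {k : Ctx φ} {t : State φ} {x j} → Truthful k t → Reach x →
                (∀ y → child x y → pos y ≡ j) → Witness x k t → StateHolds t j
      atChild {t = t} truthful ρ pos≡ (witness y c e) = subst (StateHolds t) (pos≡ y c) (truthful y (ρ ▸ c) e)

      -- Until: uEnd is checked on the letter; a false uAt/uNext would have a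
      -- false uAt/uNext child, giving an infinite chain of non-accepting states.
      module UntilSound {A φ ψ} (k : Ctx (U[ A ] φ ψ)) (ihφ : Sound φ) (ihψ : Sound ψ) where

        end-true : ∀ q → Truthful k (uEnd q)
        end-true q x ρ e = Sat-truth⁻ (finalStep? A q (act (pos x))) (proj₂ (respects-at k (uEnd q) e))

        Failing : Node → Set
        Failing y = Reach y × ((∃ λ q → st y ≡ embed k (uAt q) × ¬ StateHolds (uAt {A} {φ} {ψ} q) (pos y)) ⊎
                               (∃ λ q → st y ≡ embed k (uNext q) × ¬ StateHolds (uNext {A} {φ} {ψ} q) (pos y)))

        failing-pending : ∀ y → Failing y → accepting (st y) ≡ false
        failing-pending y (_ , inj₁ (q , e , _)) = trans (cong accepting e) (accepting-embed k (uAt q))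
        failing-pending y (_ , inj₂ (q , e , _)) = trans (cong accepting e) (accepting-embed k (uNext q))

        failing-child : ∀ y → Failing y → Σ Node λ z → child y z × Failing z
        failing-child y (ρ , inj₁ (q , e , ¬u)) with respects-at k (uAt q) e
        ... | pos≡ , inj₁ (zψ , zEnd) =
              ⊥-elim (¬u (0 , atChild (ihψ (into cUr k) self) ρ pos≡ zψ , atChild (end-true q) ρ pos≡ zEnd))
        ... | pos≡ , inj₂ (zφ , witness z c ez) = z , c , ρ ▸ c , inj₂ (q , ez , ¬next)
          where
          ¬next : ¬ StateHolds (uNext {A} {φ} {ψ} q) (pos z)
          ¬next next with subst (StateHolds (uNext {A} {φ} {ψ} q)) (pos≡ z c) next
          ... | q′ , m , k′ , u = ¬u (suc k′ , atChild (ihφ (into cUl k) self) ρ pos≡ zφ , q′ , m , u)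
        failing-child y (ρ , inj₂ (q , e , ¬n)) with respects-at k (uNext q) e
        ... | pos≡ , sat with Sat-anyOf⁻ uAt (successors A q (act (pos y))) sat
        ...   | q′ , m , witness z c ez =
                z , c , ρ ▸ c , inj₁ (q′ , ez , λ u → ¬n (q′ , m , subst (λ j → ∃ (UntilIn A φ ψ q′ j)) (pos≡ z c) u))

        at-true : ∀ q → Truthful k (uAt q)
        at-true q x ρ e with em {StateHolds (uAt {A} {φ} {ψ} q) (pos x)}
        ... | yes u = u
        ... | no ¬u with infiniteChain failing-child (ρ , inj₁ (q , e , ¬u))
        ...   | c , c0 , chain , failing = ⊥-elim (no-pending-chain ρ c c0 chain (λ n → failing-pending (c n) (failing n)))

        next-true : ∀ q → Truthful k (uNext q)
        next-true q x ρ e with respects-at k (uNext q) e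
        ... | pos≡ , sat with Sat-anyOf⁻ uAt (successors A q (act (pos x))) sat
        ...   | q′ , m , z = q′ , m , atChild (at-true q′) ρ pos≡ z

      -- Release: a reachable rAt-node satisfies the window condition of
      -- every length n, by induction on n through its rNext-children.
      module ReleaseSound {A φ ψ} (k : Ctx (R[ A ] φ ψ)) (ihφ : Sound φ) (ihψ : Sound ψ) where

        end-true : ∀ q → Truthful k (rEnd q)
        end-true q x ρ e = Sat-truth⁻ (¬? (finalStep? A q (act (pos x)))) (proj₂ (respects-at k (rEnd q) e))

        at-true-upto : ∀ n q x → Reach x → st x ≡ embed k (rAt q) → ReleaseIn A φ ψ q (pos x) n
        at-true-upto zero q x ρ e with respects-at k (rAt q) e
        ... | pos≡ , inj₁ zψ , _ = inj₂ (atChild (ihψ (into cRr k) self) ρ pos≡ zψ)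
        ... | pos≡ , inj₂ zEnd , _ = inj₁ (atChild (end-true q) ρ pos≡ zEnd)
        at-true-upto (suc n) q x ρ e with respects-at k (rAt q) e
        ... | pos≡ , _ , inj₁ zφ = inj₁ (atChild (ihφ (into cRl k) self) ρ pos≡ zφ)
        ... | pos≡ , _ , inj₂ (witness y c ey) with respects-at k (rNext q) ey
        ...   | pos≡′ , sat = inj₂ λ q′ m → later q′ (subst (λ i → q′ ∈ₗ successors A q (act i)) (sym (pos≡ y c)) m)
          where
          later : ∀ q′ → q′ ∈ₗ successors A q (act (pos y)) → ReleaseIn A φ ψ q′ (suc (pos x)) n
          later q′ m with Sat-allOf⁻ rAt sat q′ m
          ... | witness z c′ ez = subst (λ i → ReleaseIn A φ ψ q′ i n) (trans (pos≡′ z c′) (cong suc (pos≡ y c)))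
                                    (at-true-upto n q′ z ((ρ ▸ c) ▸ c′) ez)

        at-true : ∀ q → Truthful k (rAt q)
        at-true q x ρ e n = at-true-upto n q x ρ e

        next-true : ∀ q → Truthful k (rNext q)
        next-true q x ρ e with respects-at k (rNext q) e
        ... | pos≡ , sat = λ q′ m → atChild (at-true q′) ρ pos≡ (Sat-allOf⁻ rAt sat q′ m)

      sound : ∀ φ → Sound φ
      sound (φ ∧ᶠ ψ) k (sub c∧l s) = sound φ (into c∧l k) s
      sound (φ ∧ᶠ ψ) k (sub c∧r s) = sound ψ (into c∧r k) s
      sound (φ ∨ᶠ ψ) k (sub c∨l s) = sound φ (into c∨l k) s
      sound (φ ∨ᶠ ψ) k (sub c∨r s) = sound ψ (into c∨r k) s
      sound (U[ A ] φ ψ) k (sub cUl s) = sound φ (into cUl k) s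
      sound (U[ A ] φ ψ) k (sub cUr s) = sound ψ (into cUr k) s
      sound (R[ A ] φ ψ) k (sub cRl s) = sound φ (into cRl k) s
      sound (R[ A ] φ ψ) k (sub cRr s) = sound ψ (into cRr k) s
      sound (ap p) k self x ρ e = Sat-truth⁻ (p ∈? proj₁ (w (pos x))) (proj₂ (respects-at k self e))
      sound (nap p) k self x ρ e = Sat-truth⁻ (¬? (p ∈? proj₁ (w (pos x)))) (proj₂ (respects-at k self e))
      sound (φ ∧ᶠ ψ) k self x ρ e with respects-at k self e
      ... | pos≡ , zφ , zψ = atChild (sound φ (into c∧l k) self) ρ pos≡ zφ , atChild (sound ψ (into c∧r k) self) ρ pos≡ zψ
      sound (φ ∨ᶠ ψ) k self x ρ e with respects-at k self e
      ... | pos≡ , inj₁ zφ = inj₁ (atChild (sound φ (into c∨l k) self) ρ pos≡ zφ)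
      ... | pos≡ , inj₂ zψ = inj₂ (atChild (sound ψ (into c∨r k) self) ρ pos≡ zψ)
      sound (U[ A ] φ ψ) k self x ρ e with respects-at k self e
      ... | pos≡ , sat with Sat-anyOf⁻ uAt (initials A) sat
      ...   | q , m , z = q , initial⁻ A m , atChild (UntilSound.at-true k (sound φ) (sound ψ) q) ρ pos≡ z
      sound (U[ A ] φ ψ) k (uAt q) = UntilSound.at-true k (sound φ) (sound ψ) q
      sound (U[ A ] φ ψ) k (uEnd q) = UntilSound.end-true k (sound φ) (sound ψ) q
      sound (U[ A ] φ ψ) k (uNext q) = UntilSound.next-true k (sound φ) (sound ψ) q
      sound (R[ A ] φ ψ) k self x ρ e with respects-at k self e
      ... | pos≡ , sat = λ q qI → atChild (ReleaseSound.at-true k (sound φ) (sound ψ) q) ρ pos≡ (Sat-allOf⁻ rAt sat q (initial⁺ A qI))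
      sound (R[ A ] φ ψ) k (rAt q) = ReleaseSound.at-true k (sound φ) (sound ψ) q
      sound (R[ A ] φ ψ) k (rEnd q) = ReleaseSound.end-true k (sound φ) (sound ψ) q
      sound (R[ A ] φ ψ) k (rNext q) = ReleaseSound.next-true k (sound φ) (sound ψ) q

      holds-at-root : Holds 0 Φ
      holds-at-root = subst (λ i → Holds i Φ) rootPos
        (sound Φ top self root start (trans (cong (decode S) rootState) (decode-encode S self)))

    accepts⇔Holds : ExcludedMiddle 0ℓ → ∀ Φ → ABAAccepts (aut Φ) w ⇔ Holds 0 Φ
    accepts⇔Holds em Φ = mk⇔ (Soundness.holds-at-root em Φ) (completeness em Φ)

  ≤-by-slack : ∀ {a b} c → a + c ≡ b → a ≤ b
  ≤-by-slack {a} c eq = subst (a ≤_) eq (m≤m+n a c)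

  -- summing over the states of an until/release (U and R have the same coding)
  temporal-total : ∀ A φ ψ (f : Code (U[ A ] φ ψ) → ℕ) → let n = NFA.nStates A in
    total (finiteCode (U[ A ] φ ψ)) f ≡
      f (inj₁ tt) + 0 +
      ((total (finiteState φ) (λ s → f (inj₂ (inj₁ (inj₁ s)))) + total (finiteState ψ) (λ s → f (inj₂ (inj₁ (inj₂ s))))) +
       (∑ n (λ q → f (inj₂ (inj₂ (inj₁ q)))) + (∑ n (λ q → f (inj₂ (inj₂ (inj₂ (inj₁ q))))) + ∑ n (λ q → f (inj₂ (inj₂ (inj₂ (inj₂ q))))))))
  temporal-total A φ ψ f =
    trans (total-⊕ finite-⊤ ((Sφ ⊕ Sψ) ⊕ (Fn ⊕ (Fn ⊕ Fn))) f) (cong (f (inj₁ tt) + 0 +_)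
      (trans (total-⊕ (Sφ ⊕ Sψ) (Fn ⊕ (Fn ⊕ Fn)) (λ z → f (inj₂ z)))
             (cong₂ _+_ (total-⊕ Sφ Sψ (λ z → f (inj₂ (inj₁ z))))
                        (trans (total-⊕ Fn (Fn ⊕ Fn) (λ z → f (inj₂ (inj₂ z))))
                               (cong (∑ (NFA.nStates A) (λ q → f (inj₂ (inj₂ (inj₁ q)))) +_) (total-⊕ Fn Fn (λ z → f (inj₂ (inj₂ (inj₂ z))))))))))
    where
    Sφ = finiteState φ
    Sψ = finiteState ψ
    Fn = finite-Fin (NFA.nStates A)

  temporal-bound : ∀ A {x y X Y} → x ≤ 11 * X → y ≤ 11 * Y → let n = NFA.nStates A in
    1 + 2 * n + 0 + ((x + y) + (∑ n (λ _ → 7) + (∑ n (λ _ → 1) + ∑ n (λ q → 1 + 2 * outDegree A q))))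
      ≤ 11 * suc (nfaSize A + X + Y)
  temporal-bound A {x} {y} {X} {Y} x≤ y≤ = begin
    1 + 2 * n + 0 + ((x + y) + (∑ n (λ _ → 7) + (∑ n (λ _ → 1) + ∑ n (λ q → 1 + 2 * outDegree A q))))
      ≡⟨ cong (λ z → 1 + 2 * n + 0 + ((x + y) + z)) nfa-part ⟩
    1 + 2 * n + 0 + ((x + y) + (n * 7 + (n * 1 + (n * 1 + 2 * t))))
      ≤⟨ +-monoʳ-≤ (1 + 2 * n + 0) (+-monoˡ-≤ _ (+-mono-≤ x≤ y≤)) ⟩
    1 + 2 * n + 0 + ((11 * X + 11 * Y) + (n * 7 + (n * 1 + (n * 1 + 2 * t))))
      ≤⟨ ≤-by-slack (10 + 9 * t) (arith n t X Y) ⟩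
    11 * suc (nfaSize A + X + Y) ∎
    where
    open ≤-Reasoning
    n = NFA.nStates A
    t = length (NFA.transitions A)
    nfa-part : ∑ n (λ _ → 7) + (∑ n (λ _ → 1) + ∑ n (λ q → 1 + 2 * outDegree A q)) ≡ n * 7 + (n * 1 + (n * 1 + 2 * t))
    nfa-part = cong₂ _+_ (∑-const n 7) (cong₂ _+_ (∑-const n 1)
                 (trans (∑-+ n _ _) (cong₂ _+_ (∑-const n 1) (trans (∑-*ˡ n 2 _) (cong (2 *_) (∑-outDegree A))))))
    arith : ∀ n t X Y → 1 + 2 * n + 0 + ((11 * X + 11 * Y) + (n * 7 + (n * 1 + (n * 1 + 2 * t)))) + (10 + 9 * t)
                        ≡ 11 * suc (n + t + X + Y)
    arith = solve-∀

  binary-total : ∀ {φ ψ} (f : ⊤ ⊎ (State φ ⊎ State ψ) → ℕ) →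
    total (finite-⊤ ⊕ (finiteState φ ⊕ finiteState ψ)) f ≡
      f (inj₁ tt) + 0 + (total (finiteState φ) (λ s → f (inj₂ (inj₁ s))) + total (finiteState ψ) (λ s → f (inj₂ (inj₂ s))))
  binary-total {φ} {ψ} f = trans (total-⊕ finite-⊤ (finiteState φ ⊕ finiteState ψ) f)
                                 (cong (f (inj₁ tt) + 0 +_) (total-⊕ (finiteState φ) (finiteState ψ) (λ z → f (inj₂ z))))

  binary-bound : ∀ φ ψ {T} → T ≡ 3 + (total (finiteState φ) weight + total (finiteState ψ) weight) → T ≤ 11 * suc (∣ φ ∣ + ∣ ψ ∣)
  total-weight : ∀ φ → total (finiteState φ) weight ≤ 11 * ∣ φ ∣
  total-weight (ap _) = s≤s z≤n
  total-weight (nap _) = s≤s z≤n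
  total-weight (φ ∧ᶠ ψ) = binary-bound φ ψ (binary-total (λ c → weight (fromCode {φ ∧ᶠ ψ} c)))
  total-weight (φ ∨ᶠ ψ) = binary-bound φ ψ (binary-total (λ c → weight (fromCode {φ ∨ᶠ ψ} c)))
  total-weight (U[ A ] φ ψ) = ≤-trans (≤-reflexive (temporal-total A φ ψ (λ c → weight (fromCode {U[ A ] φ ψ} c))))
                                      (temporal-bound A (total-weight φ) (total-weight ψ))
  total-weight (R[ A ] φ ψ) = ≤-trans (≤-reflexive (temporal-total A φ ψ (λ c → weight (fromCode {R[ A ] φ ψ} c))))
                                      (temporal-bound A (total-weight φ) (total-weight ψ))

  binary-bound φ ψ refl = ≤-trans (+-monoʳ-≤ 3 (+-mono-≤ (total-weight φ) (total-weight ψ)))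
                                  (≤-by-slack 8 (arith ∣ φ ∣ ∣ ψ ∣))
    where
    arith : ∀ X Y → 3 + (11 * X + 11 * Y) + 8 ≡ 11 * suc (X + Y)
    arith = solve-∀

  -- Size: every state contributes at most (1 + N) times its weight, where
  -- N counts the possible transition labels (ε and all letters).

  transitionLabels : List (Maybe Letter)
  transitionLabels = nothing ∷ map just letters

  N : ℕ
  N = length transitionLabels

  cost : ∀ {φ} → State φ → ℕ
  cost s = sum (map (λ l → pbfSize (fires (move s) l)) transitionLabels)

  cost-bound : ∀ {φ} (s : State φ) → cost s ≤ N * weight s
  cost-bound s = sum-map-≤ _ (pbfSize-fires (move s) (weight-pos s) (move-bounded s)) transitionLabels

  abaSize-bound : ∀ Φ → abaSize (aut Φ) ≤ ((1 + N) * 11) * ∣ Φ ∣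
  abaSize-bound Φ = begin
    abaSize (aut Φ)                              ≡⟨ cong (size S +_) costs ⟩
    size S + total S cost                        ≤⟨ +-mono-≤ states (∑-mono (size S) (λ f → cost-bound (decode S f))) ⟩
    total S weight + total S (λ s → N * weight s) ≡⟨ cong (total S weight +_) (∑-*ˡ (size S) N _) ⟩
    (1 + N) * total S weight                     ≤⟨ *-monoʳ-≤ (1 + N) (total-weight Φ) ⟩
    (1 + N) * (11 * ∣ Φ ∣)                       ≡⟨ sym (*-assoc (1 + N) 11 ∣ Φ ∣) ⟩
    ((1 + N) * 11) * ∣ Φ ∣                       ∎
    where
    open ≤-Reasoning
    S = finiteState Φ
    perState : Fin (size S) → ℕ
    perState f = sum (map (λ l → pbfSize (ABA.δ (aut Φ) f l)) transitionLabels)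
    costs : sum (map perState (allFin (size S))) ≡ total S cost
    costs = trans (cong sum (map-tabulate {n = size S} (λ f → f) perState))
                  (∑-cong (size S) (λ f → cong sum (map-cong (λ l → pbfSize-map (encode S) _) transitionLabels)))
    states : size S ≤ total S weight
    states = subst (_≤ total S weight) (trans (∑-const (size S) 1) (*-identityʳ (size S)))
                   (∑-mono (size S) (λ f → weight-pos (decode S f)))

mainTheorem17 : (∀ {ℓ} → ExcludedMiddle ℓ) → (nAP nΣ : ℕ) →
    let open LTLREG nAP nΣ in
      Σ ℕ λ c → ∀ (φ : Formula) → Σ ABA λ A →
        (∀ (w : Word) → ABAAccepts A w ⇔ Lφ φ w) × abaSize A ≤ c * ∣ φ ∣
mainTheorem17 em nAP nΣ = (1 + N) * 11 , λ φ → aut φ , (λ w → correct w φ) , abaSize-bound φ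
  where
  open LTLREG nAP nΣ
  open Construction nAP nΣ

  correct : ∀ w φ → ABAAccepts (aut φ) w ⇔ Lφ φ w
  correct w φ = mk⇔ (λ acc → bwd language (fwd automaton acc)) (λ l → bwd automaton (fwd language l))
    where
    open Semantics w
    automaton = accepts⇔Holds em φ
    language = language⇔Holds em φ
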